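{- Let $q$ be a prime power and $n,k_1,k_2,t$ positive integers with $n\geq k_1+k_2+t+3$, $k_1\geq k_2\geq t+1$, and $k_1>k_2$. Then $g_3(k_2,k_1,n,t)<g_3(k_1,k_2,n,t)$, where $g_3(k,\ell,n,t)={n-t-1\brack k-t-1}\left(q^{\ell-t}{t+1\brack 1}{n-t-1\brack \ell-t}+{n-t-1\brack \ell-t-1}\right)$.
   Context: Gaussian binomial coefficient: ${a\brack b}=\prod_{0\leq i<b}\frac{q^{a-i}-1}{q^{b-i}-1}$ for positive integers $a,b$, with ${a\brack 0}=1$ and ${a\brack c}=0$ for negative $c$. -}

module Defs where

open import Data.Nat as ℕ using (ℕ; zero; suc; _∸_; _^_)
open import Data.Nat.Primality using (Prime)
open import Data.Product using (Σ; _×_)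
open import Relation.Binary.PropositionalEquality using (_≡_)
open import Data.Integer using (+_)
open import Data.Rational using (ℚ; _/_; _*_; _+_; 0ℚ; 1ℚ)

IsPrimePower : ℕ → Set
IsPrimePower q = Σ ℕ λ p → Σ ℕ λ m → Prime p × (1 ℕ.≤ m) × (q ≡ p ^ m)

-- the rational number x / y (taken to be 0 if y = 0; never used with y = 0 for q ≥ 2)
frac : ℕ → ℕ → ℚ
frac x zero    = 0ℚ
frac x (suc d) = (+ x) / suc d

gaussAux : ℕ → ℕ → ℕ → ℕ → ℚ
gaussAux q a b zero    = 1ℚ
gaussAux q a b (suc j) = gaussAux q a b j * frac (q ^ (a ∸ j) ∸ 1) (q ^ (b ∸ j) ∸ 1)

gauss : ℕ → ℕ → ℕ → ℚ
gauss q a b = gaussAux q a b b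

g3 : ℕ → ℕ → ℕ → ℕ → ℕ → ℚ
g3 q k ℓ n t =
  gauss q (n ∸ t ∸ 1) (k ∸ t ∸ 1)
    * (frac (q ^ (ℓ ∸ t)) 1 * gauss q (t ℕ.+ 1) 1 * gauss q (n ∸ t ∸ 1) (ℓ ∸ t)
       + gauss q (n ∸ t ∸ 1) (ℓ ∸ t ∸ 1))

-- Put N = n − t − 1, a = k₁ − t, b = k₂ − t, so that 1 ≤ b < a ≤ N and
-- g₃(k₂,k₁) = [N,b−1] (q^a T [N,a] + [N,a−1]),  g₃(k₁,k₂) = [N,a−1] (q^b T [N,b] + [N,b−1])
-- with T = [t+1,1] > 0. Since [N,c+1] = [N,c] (q^(N−c) − 1)/(q^(c+1) − 1), both sides equal
-- [N,a−1][N,b−1] (1 + T w(c)) for c = a − 1 resp. c = b − 1, where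
-- w(c) = q^(c+1) (q^(N−c) − 1)/(q^(c+1) − 1) = (q^(N+1) − 1)/(q^(c+1) − 1) − 1
-- is strictly decreasing in c.
module Submission where

open import Data.Nat as ℕ
  using (ℕ; zero; suc; _+_; _*_; _∸_; _^_; _≤_; _<_; _≥_; _>_; z≤n; s≤s; NonZero)
import Data.Nat.Properties as ℕ
open import Data.Nat.Primality using (prime⇒nonTrivial)
open import Data.Integer as ℤ using (+_)
import Data.Integer.Properties as ℤ
open import Data.Rational as ℚ using (ℚ; 0ℚ; 1ℚ; toℚᵘ) renaming (_<_ to _<ℚ_)
import Data.Rational.Properties as ℚ
import Data.Rational.Unnormalised as ℚᵘ
import Data.Rational.Unnormalised.Properties as ℚᵘ
import Data.Rational.Solver as ℚ-Solver
open import Data.Product using (_,_)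
open import Relation.Binary.PropositionalEquality
  using (_≡_; refl; sym; trans; cong; cong₂; subst; subst₂; module ≡-Reasoning)

open import Defs

1<m^n : ∀ {m} n → 1 < m → 0 < n → 1 < m ^ n
1<m^n {m} n 1<m 0<n = ℕ.^-monoʳ-< m 1<m {0} {n} 0<n

m^n*[m^[o∸n]∸1]≡[m^o∸1]∸[m^n∸1] : ∀ m .{{_ : NonZero m}} {n o} → n ≤ o →
  m ^ n * (m ^ (o ∸ n) ∸ 1) ≡ (m ^ o ∸ 1) ∸ (m ^ n ∸ 1)
m^n*[m^[o∸n]∸1]≡[m^o∸1]∸[m^n∸1] m {n} {o} n≤o = begin-equality
  m ^ n * (m ^ (o ∸ n) ∸ 1)       ≡⟨ ℕ.*-distribˡ-∸ (m ^ n) (m ^ (o ∸ n)) 1 ⟩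
  m ^ n * m ^ (o ∸ n) ∸ m ^ n * 1 ≡⟨ cong₂ _∸_ (sym (ℕ.^-distribˡ-+-* m n (o ∸ n))) (ℕ.*-identityʳ (m ^ n)) ⟩
  m ^ (n + (o ∸ n)) ∸ m ^ n       ≡⟨ cong (λ e → m ^ e ∸ m ^ n) (ℕ.m+[n∸m]≡n n≤o) ⟩
  m ^ o ∸ m ^ n                   ≡⟨ cong (m ^ o ∸_) (ℕ.m+[n∸m]≡n (ℕ.m^n>0 m n)) ⟨
  m ^ o ∸ (1 + (m ^ n ∸ 1))       ≡⟨ ℕ.∸-+-assoc (m ^ o) 1 (m ^ n ∸ 1) ⟨
  (m ^ o ∸ 1) ∸ (m ^ n ∸ 1)       ∎
  where open ℕ.≤-Reasoning

[p∸d′]*d<[p∸d]*d′ : ∀ {p d d′} → d < d′ → d′ ≤ p → (p ∸ d′) * d < (p ∸ d) * d′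
[p∸d′]*d<[p∸d]*d′ {p} {d} {d′} d<d′ d′≤p = ℕ.+-cancelʳ-< (d * d′) _ _ (begin-strict
  (p ∸ d′) * d + d * d′ ≡⟨ cong (λ e → (p ∸ d′) * d + e) (ℕ.*-comm d d′) ⟩
  (p ∸ d′) * d + d′ * d ≡⟨ complete d d′ d′≤p ⟩
  p * d                 <⟨ ℕ.*-monoʳ-< p d<d′ ⟩
  p * d′                ≡⟨ complete d′ d (ℕ.≤-trans (ℕ.<⇒≤ d<d′) d′≤p) ⟨
  (p ∸ d) * d′ + d * d′ ∎)
  where
  open ℕ.≤-Reasoning
  instance _ = ℕ.>-nonZero (ℕ.<-≤-trans (ℕ.≤-<-trans z≤n d<d′) d′≤p)
  complete : ∀ x y → y ≤ p → (p ∸ y) * x + y * x ≡ p * x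
  complete x y y≤p = trans (cong (_+ y * x) (ℕ.*-distribʳ-∸ x p y))
                           (ℕ.m∸n+n≡m (ℕ.*-monoˡ-≤ x y≤p))

toℚᵘ-frac-suc : ∀ x d → toℚᵘ (frac x (suc d)) ℚᵘ.≃ ℚᵘ.mkℚᵘ (+ x) d
toℚᵘ-frac-suc x d = ℚ.toℚᵘ-fromℚᵘ (ℚᵘ.mkℚᵘ (+ x) d)

frac-* : ∀ x y x′ y′ → frac x y ℚ.* frac x′ y′ ≡ frac (x * x′) (y * y′)
frac-* x zero    x′ y′      = ℚ.*-zeroˡ (frac x′ y′)
frac-* x (suc d) x′ zero    rewrite ℕ.*-zeroʳ d = ℚ.*-zeroʳ (frac x (suc d))
frac-* x (suc d) x′ (suc d′) = ℚ.toℚᵘ-injective (begin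
  toℚᵘ (frac x (suc d) ℚ.* frac x′ (suc d′))
    ≈⟨ ℚ.toℚᵘ-homo-* (frac x (suc d)) (frac x′ (suc d′)) ⟩
  toℚᵘ (frac x (suc d)) ℚᵘ.* toℚᵘ (frac x′ (suc d′))
    ≈⟨ ℚᵘ.*-cong (toℚᵘ-frac-suc x d) (toℚᵘ-frac-suc x′ d′) ⟩
  ℚᵘ.mkℚᵘ (+ x ℤ.* + x′) (ℕ.pred (suc d * suc d′))
    ≡⟨ cong (λ z → ℚᵘ.mkℚᵘ z (ℕ.pred (suc d * suc d′))) (ℤ.pos-* x x′) ⟨
  ℚᵘ.mkℚᵘ (+ (x * x′)) (ℕ.pred (suc d * suc d′))
    ≈⟨ toℚᵘ-frac-suc (x * x′) (ℕ.pred (suc d * suc d′)) ⟨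
  toℚᵘ (frac (x * x′) (suc d * suc d′)) ∎)
  where open ℚᵘ.≃-Reasoning

frac-< : ∀ {x y x′ y′} → 0 < y → 0 < y′ → x * y′ < x′ * y → frac x y <ℚ frac x′ y′
frac-< {x} {suc d} {x′} {suc d′} _ _ lt = ℚ.toℚᵘ-cancel-<
  (ℚᵘ.<-respˡ-≃ (ℚᵘ.≃-sym (toℚᵘ-frac-suc x d)) (ℚᵘ.<-respʳ-≃ (ℚᵘ.≃-sym (toℚᵘ-frac-suc x′ d′))
    (ℚᵘ.*<* (subst₂ ℤ._<_ (ℤ.pos-* x (suc d′)) (ℤ.pos-* x′ (suc d)) (ℤ.+<+ lt)))))

frac-pos : ∀ {x y} → 0 < x → 0 < y → 0ℚ <ℚ frac x y
frac-pos {suc x} {suc d} _ _ = ℚ.positive⁻¹ (frac (suc x) (suc d)) {{ℚ.normalize-pos (suc x) (suc d)}}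

*-pos : ∀ {p r} → 0ℚ <ℚ p → 0ℚ <ℚ r → 0ℚ <ℚ p ℚ.* r
*-pos {p} {r} 0<p 0<r = ℚ.positive⁻¹ (p ℚ.* r) {{ℚ.pos*pos⇒pos p {{ℚ.positive 0<p}} r {{ℚ.positive 0<r}}}}

qFalling : ℕ → ℕ → ℕ → ℕ
qFalling q a zero    = 1
qFalling q a (suc j) = qFalling q a j * (q ^ (a ∸ j) ∸ 1)

gaussAux≡frac : ∀ q a b j → gaussAux q a b j ≡ frac (qFalling q a j) (qFalling q b j)
gaussAux≡frac q a b zero    = refl
gaussAux≡frac q a b (suc j) =
  trans (cong (ℚ._* frac (q ^ (a ∸ j) ∸ 1) (q ^ (b ∸ j) ∸ 1)) (gaussAux≡frac q a b j))
        (frac-* (qFalling q a j) (qFalling q b j) _ _)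

qFalling-suc : ∀ q b j → qFalling q (suc b) (suc j) ≡ qFalling q b j * (q ^ suc b ∸ 1)
qFalling-suc q b zero    = refl
qFalling-suc q b (suc j) = begin
  qFalling q (suc b) (suc j) * (q ^ (b ∸ j) ∸ 1)
    ≡⟨ cong (_* (q ^ (b ∸ j) ∸ 1)) (qFalling-suc q b j) ⟩
  qFalling q b j * (q ^ suc b ∸ 1) * (q ^ (b ∸ j) ∸ 1)
    ≡⟨ ℕ.*-assoc (qFalling q b j) _ _ ⟩
  qFalling q b j * ((q ^ suc b ∸ 1) * (q ^ (b ∸ j) ∸ 1))
    ≡⟨ cong (qFalling q b j ℕ.*_) (ℕ.*-comm (q ^ suc b ∸ 1) _) ⟩
  qFalling q b j * ((q ^ (b ∸ j) ∸ 1) * (q ^ suc b ∸ 1))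
    ≡⟨ ℕ.*-assoc (qFalling q b j) _ _ ⟨
  qFalling q b (suc j) * (q ^ suc b ∸ 1) ∎
  where open ≡-Reasoning

gaussStep : ℕ → ℕ → ℕ → ℚ
gaussStep q N c = frac (q ^ (N ∸ c) ∸ 1) (q ^ suc c ∸ 1)

gauss-suc : ∀ q N c → gauss q N (suc c) ≡ gauss q N c ℚ.* gaussStep q N c
gauss-suc q N c = begin
  gauss q N (suc c)
    ≡⟨ gaussAux≡frac q N (suc c) (suc c) ⟩
  frac (qFalling q N c * (q ^ (N ∸ c) ∸ 1)) (qFalling q (suc c) (suc c))
    ≡⟨ cong (frac (qFalling q N c * (q ^ (N ∸ c) ∸ 1))) (qFalling-suc q c c) ⟩
  frac (qFalling q N c * (q ^ (N ∸ c) ∸ 1)) (qFalling q c c * (q ^ suc c ∸ 1))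
    ≡⟨ frac-* (qFalling q N c) (qFalling q c c) _ _ ⟨
  frac (qFalling q N c) (qFalling q c c) ℚ.* gaussStep q N c
    ≡⟨ cong (ℚ._* gaussStep q N c) (gaussAux≡frac q N c c) ⟨
  gauss q N c ℚ.* gaussStep q N c ∎
  where open ≡-Reasoning

0<q^n∸1 : ∀ {q} n → 1 < q → 0 < n → 0 < q ^ n ∸ 1
0<q^n∸1 n 1<q 0<n = ℕ.m<n⇒0<n∸m (1<m^n n 1<q 0<n)

gaussAux-pos : ∀ {q a b} j → 1 < q → j ≤ a → j ≤ b → 0ℚ <ℚ gaussAux q a b j
gaussAux-pos zero    1<q _   _   = ℚ.positive⁻¹ 1ℚ
gaussAux-pos {q} {a} {b} (suc j) 1<q j<a j<b = *-pos
  (gaussAux-pos j 1<q (ℕ.<⇒≤ j<a) (ℕ.<⇒≤ j<b))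
  (frac-pos (0<q^n∸1 (a ∸ j) 1<q (ℕ.m<n⇒0<n∸m j<a)) (0<q^n∸1 (b ∸ j) 1<q (ℕ.m<n⇒0<n∸m j<b)))

gauss-pos : ∀ {q N c} → 1 < q → c ≤ N → 0ℚ <ℚ gauss q N c
gauss-pos {c = c} 1<q c≤N = gaussAux-pos c 1<q c≤N ℕ.≤-refl

q^suc*gaussStep≡frac : ∀ q .{{_ : NonZero q}} {N c} → c ≤ N →
  frac (q ^ suc c) 1 ℚ.* gaussStep q N c ≡ frac ((q ^ suc N ∸ 1) ∸ (q ^ suc c ∸ 1)) (q ^ suc c ∸ 1)
q^suc*gaussStep≡frac q {N} {c} c≤N = begin
  frac (q ^ suc c) 1 ℚ.* gaussStep q N c
    ≡⟨ frac-* (q ^ suc c) 1 (q ^ (N ∸ c) ∸ 1) (q ^ suc c ∸ 1) ⟩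
  frac (q ^ suc c * (q ^ (N ∸ c) ∸ 1)) (1 * (q ^ suc c ∸ 1))
    ≡⟨ cong₂ frac (m^n*[m^[o∸n]∸1]≡[m^o∸1]∸[m^n∸1] q (s≤s c≤N)) (ℕ.*-identityˡ (q ^ suc c ∸ 1)) ⟩
  frac ((q ^ suc N ∸ 1) ∸ (q ^ suc c ∸ 1)) (q ^ suc c ∸ 1) ∎
  where open ≡-Reasoning

q^suc*gaussStep-antitone : ∀ {q N c c′} → 1 < q → c < c′ → c′ < N →
  frac (q ^ suc c′) 1 ℚ.* gaussStep q N c′ <ℚ frac (q ^ suc c) 1 ℚ.* gaussStep q N c
q^suc*gaussStep-antitone {q} {N} {c} {c′} 1<q c<c′ c′<N =
  subst₂ _<ℚ_ (sym (q^suc*gaussStep≡frac q (ℕ.<⇒≤ c′<N)))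
               (sym (q^suc*gaussStep≡frac q (ℕ.<⇒≤ (ℕ.<-trans c<c′ c′<N))))
    (frac-< (0<q^n∸1 (suc c′) 1<q (s≤s z≤n)) (0<q^n∸1 (suc c) 1<q (s≤s z≤n))
      ([p∸d′]*d<[p∸d]*d′ (ℕ.∸-monoˡ-< (q^-< (s≤s c<c′)) (ℕ.<⇒≤ (1<m^n (suc c) 1<q (s≤s z≤n))))
                         (ℕ.∸-monoˡ-≤ 1 (ℕ.<⇒≤ (q^-< (s≤s c′<N))))))
  where
  instance _ = ℕ.>-nonZero (ℕ.<-trans (s≤s z≤n) 1<q)
  q^-< : ∀ {m n} → m < n → q ^ m < q ^ n
  q^-< = ℕ.^-monoʳ-< q 1<q

gauss-exchange-< : ∀ {q N} T a b → 1 < q → 0ℚ <ℚ T → 0 < b → b < a → a ≤ N →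
  gauss q N (b ∸ 1) ℚ.* (frac (q ^ a) 1 ℚ.* T ℚ.* gauss q N a ℚ.+ gauss q N (a ∸ 1))
    <ℚ gauss q N (a ∸ 1) ℚ.* (frac (q ^ b) 1 ℚ.* T ℚ.* gauss q N b ℚ.+ gauss q N (b ∸ 1))
gauss-exchange-< {q} {N} T (suc α) (suc β) 1<q 0<T (s≤s z≤n) (s≤s β<α) α<N
  rewrite gauss-suc q N α | gauss-suc q N β =
  subst₂ _<ℚ_ (sym (factor Gβ Gα (frac (q ^ suc α) 1) (gaussStep q N α)))
               (sym (trans (factor Gα Gβ (frac (q ^ suc β) 1) (gaussStep q N β))
                           (cong (λ P → P ℚ.* T ℚ.* (frac (q ^ suc β) 1 ℚ.* gaussStep q N β) ℚ.+ P) (ℚ.*-comm Gα Gβ))))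
    (ℚ.+-monoˡ-< (Gβ ℚ.* Gα) (ℚ.*-monoʳ-<-pos (Gβ ℚ.* Gα ℚ.* T) {{ℚ.positive 0<GβGαT}}
      (q^suc*gaussStep-antitone 1<q β<α α<N)))
  where
  Gα = gauss q N α
  Gβ = gauss q N β
  0<GβGαT : 0ℚ <ℚ Gβ ℚ.* Gα ℚ.* T
  0<GβGαT = *-pos (*-pos (gauss-pos 1<q (ℕ.<⇒≤ (ℕ.<-trans β<α α<N))) (gauss-pos 1<q (ℕ.<⇒≤ α<N))) 0<T
  open ℚ-Solver.+-*-Solver
  factor : ∀ x y w r → x ℚ.* (w ℚ.* T ℚ.* (y ℚ.* r) ℚ.+ y) ≡ x ℚ.* y ℚ.* T ℚ.* (w ℚ.* r) ℚ.+ x ℚ.* y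
  factor x y w r = solve 5 (λ x y w r t → x :* (w :* t :* (y :* r) :+ y) := x :* y :* t :* (w :* r) :+ x :* y)
    refl x y w r T

lemma5p7 : (q n k₁ k₂ t : ℕ) → IsPrimePower q →
    1 ≤ n → 1 ≤ k₁ → 1 ≤ k₂ → 1 ≤ t →
    n ≥ k₁ + k₂ + t + 3 → k₁ ≥ k₂ → k₂ ≥ t + 1 → k₁ > k₂ →
    g3 q k₂ k₁ n t <ℚ g3 q k₁ k₂ n t
lemma5p7 q n k₁ k₂ t (p , m , p-prime , 1≤m , refl) _ _ _ _ n≥k₁+k₂+t+3 _ t+1≤k₂ k₂<k₁ =
  gauss-exchange-< (gauss q (t + 1) 1) (k₁ ∸ t) (k₂ ∸ t) 1<q
    (gauss-pos 1<q (ℕ.m≤n+m 1 t)) (ℕ.m<n⇒0<n∸m t<k₂) (ℕ.∸-monoˡ-< k₂<k₁ (ℕ.<⇒≤ t<k₂)) k₁∸t≤n∸t∸1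
  where
  1<q : 1 < p ^ m
  1<q = 1<m^n m (ℕ.nonTrivial⇒n>1 p {{prime⇒nonTrivial p-prime}}) 1≤m
  t<k₂ : t < k₂
  t<k₂ = subst (_≤ k₂) (ℕ.+-comm t 1) t+1≤k₂
  k₁<n : k₁ < n
  k₁<n = begin-strict
    k₁              ≤⟨ ℕ.m≤m+n k₁ k₂ ⟩
    k₁ + k₂         ≤⟨ ℕ.m≤m+n (k₁ + k₂) t ⟩
    k₁ + k₂ + t     <⟨ ℕ.m<m+n (k₁ + k₂ + t) (s≤s z≤n) ⟩
    k₁ + k₂ + t + 3 ≤⟨ n≥k₁+k₂+t+3 ⟩
    n               ∎
    where open ℕ.≤-Reasoning
  k₁∸t≤n∸t∸1 : k₁ ∸ t ≤ n ∸ t ∸ 1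
  k₁∸t≤n∸t∸1 = subst (k₁ ∸ t ≤_) (trans (cong (n ∸_) (ℕ.+-comm 1 t)) (sym (ℕ.∸-+-assoc n t 1)))
                     (ℕ.∸-monoˡ-≤ (suc t) k₁<n)
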